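{- Let $G$ be a graph of maximum degree at most $3$, and let $S$ be a set of vertices of $G$. If $u$ is a vertex of degree at most $2$ in $G$, then $w_{(G,S)}(u)\leq 2$, with equality if and only if $u$ is contained in a subgraph $T$ of $G$ that is a tree such that rooting $T$ in $u$ yields a full binary tree and $S\cap V(T)$ is exactly the set of leaves of $T$.
   Context: All graphs are finite, simple and undirected. For a graph $G$ and $S\subseteq V(G)$, and vertices $u,v$ with $u\in S$ or $v\in S$, let $\mathrm{dist}_{(G,S)}(u,v)$ be the minimum number of edges of a path $P$ in $G$ between $u$ and $v$ such that $S$ contains exactly one endvertex of $P$ and no internal vertex of $P$ (and $\infty$ if no such path exists; in particular $\mathrm{dist}_{(G,S)}(u,u)=0$ for $u\in S$). For a vertex $u$, let $w_{(G,S)}(u)=\sum_{v\in S}\left(\frac{1}{2}\right)^{\mathrm{dist}_{(G,S)}(u,v)-1}$ with $(1/2)^\infty=0$. A leaf of a rooted tree is a vertex with no children; a rooted tree is a full binary tree if every vertex other than the leaves has exactly two children (a single vertex counts as a full binary tree whose only leaf is the root). -}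

module Defs where

open import Data.Bool using (Bool; true; false; _∧_; _∨_; if_then_else_)
open import Data.Nat using (ℕ; zero; suc; _+_)
open import Data.Fin using (Fin; zero; suc; toℕ; fromℕ; inject₁)
open import Data.Fin.Properties using (any?; all?)
open import Data.Vec using (Vec; []; _∷_; lookup)
open import Data.List using (List; []; _∷_; _++_; foldr; map; allFin)
open import Data.Maybe using (Maybe; just; nothing)
open import Data.Product using (Σ; ∃; _×_; _,_)
open import Data.Rational using (ℚ; 0ℚ; 1ℚ; ½) renaming (_+_ to _+ℚ_; _*_ to _*ℚ_)
open import Relation.Nullary using (Dec; yes; no; ¬_)
open import Relation.Nullary.Decidable using (⌊_⌋; _×-dec_; _→-dec_; map′; ¬?)
open import Relation.Binary.PropositionalEquality using (_≡_; _≢_; refl)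
open import Data.Bool.Properties using () renaming (_≟_ to _≟ᵇ_)
open import Data.Fin.Properties using () renaming (_≟_ to _≟ᶠ_)
open import Data.Nat.Properties using () renaming (_≟_ to _≟ℕ_)
open import Data.List.Relation.Unary.Unique.Propositional using (Unique)
open import Data.List.Relation.Unary.All using (All)

record Graph (n : ℕ) : Set where
  field
    adj   : Fin n → Fin n → Bool
    sym   : ∀ i j → adj i j ≡ adj j i
    irrefl : ∀ i → adj i i ≡ false
open Graph public

count : ∀ {n} → (Fin n → Bool) → ℕ
count {n} p = foldr (λ j acc → (if p j then 1 else 0) + acc) 0 (allFin n)

deg : ∀ {n} → Graph n → Fin n → ℕ
deg G i = count (adj G i)

VSet : ℕ → Set
VSet n = Fin n → Bool

IsSPath : ∀ {n} → Graph n → VSet n → Fin n → Fin n → (d : ℕ) → Vec (Fin n) (suc d) → Set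
IsSPath G S u v d p =
    (lookup p zero ≡ u)
  × (lookup p (fromℕ d) ≡ v)
  × (∀ (i j : Fin (suc d)) → lookup p i ≡ lookup p j → i ≡ j)
  × (∀ (i : Fin d) → adj G (lookup p (inject₁ i)) (lookup p (suc i)) ≡ true)
  -- exactly one endvertex in S (the endvertex set is {u,v})
  × (S u ∨ S v ≡ true)
  × (S u ∧ S v ≡ true → u ≡ v)
  × (∀ (i : Fin (suc d)) → toℕ i ≢ 0 → toℕ i ≢ d → S (lookup p i) ≡ false)

∃Vec? : ∀ {n} (k : ℕ) (P : Vec (Fin n) k → Set) → (∀ w → Dec (P w)) → Dec (∃ P)
∃Vec? zero P P? with P? []
... | yes p = yes ([] , p)
... | no ¬p = no λ { ([] , p) → ¬p p }
∃Vec? (suc k) P P? =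
  map′ (λ { (x , w , p) → (x ∷ w) , p }) (λ { ((x ∷ w) , p) → x , w , p })
       (any? (λ x → ∃Vec? k (λ w → P (x ∷ w)) (λ w → P? (x ∷ w))))

injective? : ∀ {n m} (f : Fin m → Fin n) → Dec (∀ i j → f i ≡ f j → i ≡ j)
injective? f = all? (λ i → all? (λ j → (f i ≟ᶠ f j) →-dec (i ≟ᶠ j)))

isSPath? : ∀ {n} (G : Graph n) (S : VSet n) u v d p → Dec (IsSPath G S u v d p)
isSPath? G S u v d p =
      (lookup p zero ≟ᶠ u)
  ×-dec (lookup p (fromℕ d) ≟ᶠ v)
  ×-dec injective? (lookup p)
  ×-dec all? (λ i → adj G (lookup p (inject₁ i)) (lookup p (suc i)) ≟ᵇ true)
  ×-dec (S u ∨ S v ≟ᵇ true)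
  ×-dec ((S u ∧ S v ≟ᵇ true) →-dec (u ≟ᶠ v))
  ×-dec all? (λ i → ¬? (toℕ i ≟ℕ 0) →-dec (¬? (toℕ i ≟ℕ d) →-dec (S (lookup p i) ≟ᵇ false)))

hasSPath? : ∀ {n} (G : Graph n) (S : VSet n) u v d → Dec (∃ (IsSPath G S u v d))
hasSPath? G S u v d = ∃Vec? (suc d) (IsSPath G S u v d) (isSPath? G S u v d)

firstLen : ∀ {n} → Graph n → VSet n → Fin n → Fin n → (fuel start : ℕ) → Maybe ℕ
firstLen G S u v zero start = nothing
firstLen G S u v (suc fuel) start =
  if ⌊ hasSPath? G S u v start ⌋ then just start else firstLen G S u v fuel (suc start)

-- dist_(G,S)(u,v) ; nothing = ∞.  A path has pairwise distinct vertices,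
-- hence length < n, so searching lengths 0..n finds the minimum if any.
dist : ∀ {n} → Graph n → VSet n → Fin n → Fin n → Maybe ℕ
dist {n} G S u v = firstLen G S u v (suc n) 0

_^ℚ_ : ℚ → ℕ → ℚ
q ^ℚ zero = 1ℚ
q ^ℚ suc k = q *ℚ (q ^ℚ k)

2ℚ : ℚ
2ℚ = 1ℚ +ℚ 1ℚ

-- (1/2)^(d-1) = 2·(1/2)^d, and (1/2)^∞ = 0
halfPowPred : Maybe ℕ → ℚ
halfPowPred nothing  = 0ℚ
halfPowPred (just d) = 2ℚ *ℚ (½ ^ℚ d)

sumℚ : ∀ {n} → (Fin n → ℚ) → ℚ
sumℚ {n} f = foldr (λ j acc → f j +ℚ acc) 0ℚ (allFin n)

weight : ∀ {n} → Graph n → VSet n → Fin n → ℚ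
weight G S u = sumℚ (λ v → if S v then halfPowPred (dist G S u v) else 0ℚ)

-- Together with
-- pairwise distinctness of all vertices this is exactly a subgraph of G that
-- is a tree and that, rooted at r, is a full binary tree.

data FBT {n} (G : Graph n) : Fin n → Set where
  leaf : ∀ {r} → FBT G r
  node : ∀ {r} (a b : Fin n) → adj G r a ≡ true → adj G r b ≡ true →
         FBT G a → FBT G b → FBT G r

vertices : ∀ {n} {G : Graph n} {r} → FBT G r → List (Fin n)
vertices {r = r} leaf = r ∷ []
vertices {r = r} (node a b _ _ ta tb) = r ∷ (vertices ta ++ vertices tb)

leaves : ∀ {n} {G : Graph n} {r} → FBT G r → List (Fin n)
leaves {r = r} leaf = r ∷ []
leaves (node a b _ _ ta tb) = leaves ta ++ leaves tb

internals : ∀ {n} {G : Graph n} {r} → FBT G r → List (Fin n)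
internals leaf = []
internals {r = r} (node a b _ _ ta tb) = r ∷ (internals ta ++ internals tb)

GoodTree : ∀ {n} → Graph n → VSet n → Fin n → Set
GoodTree G S u =
  Σ (FBT G u) λ T →
      Unique (vertices T)
    × All (λ x → S x ≡ true) (leaves T)
    × All (λ x → S x ≡ false) (internals T)

-- Explore G breadth-first from u, passing only through vertices outside S: the layers
-- L₀ = {u}, L₁, … satisfy dist(u, v) ≥ j for every v ∈ S ∩ Lⱼ.  By the degree bounds each vertex
-- of Lₖ ∖ S has at most two neighbours in Lₖ₊₁ (u has degree ≤ 2; a later vertex has degree ≤ 3
-- and one neighbour in the previous layer), so  Σ_{j<k} |Lⱼ ∩ S| 2⁻ʲ + |Lₖ| 2⁻ᵏ  never increases
-- from its initial value 1, and it dominates w(u)/2.  Equality forces every vertex of Lₖ ∖ S to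
-- have exactly two neighbours in Lₖ₊₁, every vertex of Lₖ₊₁ exactly one neighbour in Lₖ ∖ S, and
-- the layers to die out: these edges form the full binary tree.  Conversely, a leaf at depth h of
-- such a tree is reached by a (G,S)-path of length h, and the leaf depths of a full binary tree
-- satisfy Kraft's equality Σ 2⁻ʰ = 1.  (If u ∈ S, only u itself contributes and T = {u}.)
--
-- All weights are multiplied by 2ⁿ, so that the counting takes place in ℕ.

module Submission where

open import Algebra.Bundles using (CommutativeRing)
import Algebra.Properties.Semiring.Mult as SemiringMult
import Algebra.Solver.CommutativeMonoid as CommutativeMonoidSolver
open import Data.Bool using (Bool; true; false; _∧_; _∨_; not; if_then_else_)
open import Data.Bool.Properties
  using (∧-conicalˡ; ∧-conicalʳ; ∨-zeroʳ; not-injective; ¬-not) renaming (_≟_ to _≟ᵇ_)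
open import Data.Empty using (⊥-elim)
open import Data.Fin using (Fin; zero; suc; toℕ; fromℕ; inject₁)
open import Data.Fin.Properties using (_≟_; any?; injective⇒≤; toℕ-fromℕ; toℕ-inject₁; toℕ<n; suc-injective)
open import Data.List as List using (List; []; _∷_; _++_)
open import Data.List.Membership.Propositional using (_∈_; _∉_)
open import Data.List.Membership.Propositional.Properties using (∈-++⁺ˡ; ∈-++⁺ʳ)
open import Data.List.Relation.Binary.Disjoint.Propositional using (Disjoint)
open import Data.List.Relation.Unary.All as All using (All; []; _∷_)
import Data.List.Relation.Unary.All.Properties as All
open import Data.List.Relation.Unary.Any using (here; there)
open import Data.List.Relation.Unary.AllPairs using ([]; _∷_)
open import Data.List.Relation.Unary.Unique.Propositional using (Unique)
import Data.List.Relation.Unary.Unique.Propositional.Properties as Unique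
open import Data.Maybe using (Maybe; just; nothing)
open import Data.Nat using (ℕ; zero; suc; _+_; _*_; _∸_; _^_; _≤_; _<_; z≤n; s≤s; _⊔_)
import Data.Nat.Properties as ℕ
open import Data.Nat.Solver using (module +-*-Solver)
open import Data.Product using (Σ; ∃; ∃₂; _×_; _,_; proj₁; proj₂)
open import Data.Rational using (ℚ; 0ℚ; 1ℚ; ½; Positive)
  renaming (_≤_ to _≤ℚ_; _<_ to _<ℚ_; _+_ to _+ℚ_; _*_ to _*ℚ_)
import Data.Rational.Properties as ℚ
open import Data.Sum using (_⊎_; inj₁; inj₂)
open import Data.Vec using (Vec; []; _∷_; lookup)
import Data.Vec.Functional as Vector
open import Function.Base using (_∘_)
open import Function.Bundles using (_⇔_; mk⇔)
open import Function.Construct.Composition using (_⇔-∘_)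
open import Relation.Binary.Definitions using (tri<; tri≈; tri>)
open import Relation.Binary.PropositionalEquality
  using (_≡_; _≢_; refl; sym; trans; cong; cong₂; subst; subst₂; module ≡-Reasoning)
open import Relation.Nullary using (¬_; Dec; yes; no; does)
open import Relation.Nullary.Decidable using (dec-true)

open import Defs hiding (sym)

open import Algebra.Properties.CommutativeMonoid.Sum ℕ.+-0-commutativeMonoid
  using (sum; sum-cong-≗; ∑-distrib-+; ∑-comm; sum-replicate-zero)
open import Algebra.Properties.Semiring.Sum ℕ.+-*-semiring using (*-distribʳ-sum)

does≡true⇒ : ∀ {a} {A : Set a} (a? : Dec A) → does a? ≡ true → A
does≡true⇒ (yes a) _ = a

∧≡true⇒ : ∀ {a b} → a ∧ b ≡ true → a ≡ true × b ≡ true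
∧≡true⇒ {a} {b} e = ∧-conicalˡ a b e , ∧-conicalʳ a b e

𝟙 : Bool → ℕ
𝟙 b = if b then 1 else 0

𝟙-split : ∀ a b → 𝟙 a ≡ 𝟙 (a ∧ b) + 𝟙 (a ∧ not b)
𝟙-split true  true  = refl
𝟙-split true  false = refl
𝟙-split false b     = refl

𝟙-∧-≤ˡ : ∀ a b → 𝟙 (a ∧ b) ≤ 𝟙 a
𝟙-∧-≤ˡ true  true  = ℕ.≤-refl
𝟙-∧-≤ˡ true  false = z≤n
𝟙-∧-≤ˡ false b     = z≤n

foldr-tabulate : ∀ {A B : Set} (g : A → B → B) (e : B) {m n} (f : Fin n → A) (h : Fin m → Fin n) →
                 List.foldr (λ j → g (f j)) e (List.tabulate h) ≡ Vector.foldr g e (f ∘ h)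
foldr-tabulate g e {zero}  f h = refl
foldr-tabulate g e {suc m} f h = cong (g (f (h zero))) (foldr-tabulate g e f (h ∘ suc))

foldr-allFin : ∀ {A B : Set} (g : A → B → B) (e : B) {n} (f : Fin n → A) →
               List.foldr (λ j → g (f j)) e (List.allFin n) ≡ Vector.foldr g e f
foldr-allFin g e f = foldr-tabulate g e f (λ i → i)

count≡sum : ∀ {n} (p : Fin n → Bool) → count p ≡ sum (𝟙 ∘ p)
count≡sum p = foldr-allFin _+_ 0 (𝟙 ∘ p)

sum-mono-≤ : ∀ {n} {f g : Fin n → ℕ} → (∀ i → f i ≤ g i) → sum f ≤ sum g
sum-mono-≤ {zero}  f≤g = z≤n
sum-mono-≤ {suc n} f≤g = ℕ.+-mono-≤ (f≤g zero) (sum-mono-≤ (f≤g ∘ suc))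

≤-sum : ∀ {n} (f : Fin n → ℕ) i → f i ≤ sum f
≤-sum f zero    = ℕ.m≤m+n _ _
≤-sum f (suc i) = ℕ.≤-trans (≤-sum (f ∘ suc) i) (ℕ.m≤n+m _ (f zero))

pointwise-≤∧sum-≡⇒≡ : ∀ {n} {f g : Fin n → ℕ} → (∀ i → f i ≤ g i) → sum f ≡ sum g → ∀ i → f i ≡ g i
pointwise-≤∧sum-≡⇒≡ {suc n} {f} {g} f≤g eq i = go i
  where
  head≡ : f zero ≡ g zero
  head≡ = ℕ.≤-antisym (f≤g zero)
            (ℕ.+-cancelʳ-≤ (sum (f ∘ suc)) _ _ (ℕ.≤-trans (ℕ.+-monoʳ-≤ (g zero) (sum-mono-≤ (f≤g ∘ suc)))
                                                            (ℕ.≤-reflexive (sym eq))))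
  go : ∀ i → f i ≡ g i
  go zero    = head≡
  go (suc i) = pointwise-≤∧sum-≡⇒≡ (f≤g ∘ suc)
                 (ℕ.+-cancelˡ-≡ (f zero) _ _ (trans eq (cong (_+ sum (g ∘ suc)) (sym head≡)))) i

sum-𝟙-split : ∀ {n} (p q : Fin n → Bool) →
              sum (𝟙 ∘ p) ≡ sum (λ i → 𝟙 (p i ∧ q i)) + sum (λ i → 𝟙 (p i ∧ not (q i)))
sum-𝟙-split p q = trans (sum-cong-≗ (λ i → 𝟙-split (p i) (q i)))
                        (∑-distrib-+ (λ i → 𝟙 (p i ∧ q i)) (λ i → 𝟙 (p i ∧ not (q i))))

point : ∀ {n} → Fin n → ℕ → Fin n → ℕ
point v c i = if does (i ≟ v) then c else 0

sum-point : ∀ {n} (v : Fin n) c → sum (point v c) ≡ c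
sum-point {suc n} zero    c = trans (cong (c +_) (sum-replicate-zero n)) (ℕ.+-identityʳ c)
sum-point {suc n} (suc v) c = sum-point v c

sum-𝟙≥1⇒∃ : ∀ {n} (p : Fin n → Bool) → 1 ≤ sum (𝟙 ∘ p) → ∃ λ i → p i ≡ true
sum-𝟙≥1⇒∃ {suc n} p 1≤ with p zero in p₀
... | true  = zero , p₀
... | false = let (i , pi) = sum-𝟙≥1⇒∃ (p ∘ suc) 1≤ in suc i , pi

sum-𝟙≥2⇒∃₂ : ∀ {n} (p : Fin n → Bool) → 2 ≤ sum (𝟙 ∘ p) → ∃₂ λ i j → i ≢ j × p i ≡ true × p j ≡ true
sum-𝟙≥2⇒∃₂ {suc n} p 2≤ with p zero in p₀
... | true  = let (j , pj) = sum-𝟙≥1⇒∃ (p ∘ suc) (ℕ.≤-pred 2≤) in zero , suc j , (λ ()) , p₀ , pj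
... | false = let (i , j , i≢j , pi , pj) = sum-𝟙≥2⇒∃₂ (p ∘ suc) 2≤ in
              suc i , suc j , i≢j ∘ suc-injective , pi , pj

two-𝟙⇒sum≥2 : ∀ {n} (p : Fin n → Bool) {i j} → i ≢ j → p i ≡ true → p j ≡ true → 2 ≤ sum (𝟙 ∘ p)
two-𝟙⇒sum≥2 p {zero}  {zero}  i≢j _  _  = ⊥-elim (i≢j refl)
two-𝟙⇒sum≥2 p {zero}  {suc j} _   pi pj rewrite pi =
  s≤s (subst (_≤ sum (𝟙 ∘ p ∘ suc)) (cong 𝟙 pj) (≤-sum (𝟙 ∘ p ∘ suc) j))
two-𝟙⇒sum≥2 p {suc i} {zero}  _   pi pj rewrite pj =
  s≤s (subst (_≤ sum (𝟙 ∘ p ∘ suc)) (cong 𝟙 pi) (≤-sum (𝟙 ∘ p ∘ suc) i))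
two-𝟙⇒sum≥2 p {suc i} {suc j} i≢j pi pj =
  ℕ.≤-trans (two-𝟙⇒sum≥2 (p ∘ suc) (i≢j ∘ cong suc) pi pj) (ℕ.m≤n+m _ (𝟙 (p zero)))

sum-𝟙≤1⇒unique : ∀ {n} (p : Fin n → Bool) → sum (𝟙 ∘ p) ≤ 1 → ∀ {i j} → p i ≡ true → p j ≡ true → i ≡ j
sum-𝟙≤1⇒unique p ≤1 {i} {j} pi pj with i ≟ j
... | yes i≡j = i≡j
... | no  i≢j = ⊥-elim (ℕ.<⇒≱ (two-𝟙⇒sum≥2 p i≢j pi pj) ≤1)

module _ {n} (G : Graph n) (S : VSet n) (u v : Fin n) where

  private
    firstLen≡just⇒path : ∀ fuel start {d} → firstLen G S u v fuel start ≡ just d →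
                         ∃ (IsSPath G S u v d) × d < start + fuel
    firstLen≡just⇒path (suc fuel) start {d} eq with hasSPath? G S u v start
    ... | yes P with refl ← eq = P , ℕ.m<m+n start (s≤s z≤n)
    ... | no _ = let (P , d<) = firstLen≡just⇒path fuel (suc start) eq in
                 P , subst (d <_) (sym (ℕ.+-suc start fuel)) d<

    path⇒firstLen≤ : ∀ fuel start {h p} → IsSPath G S u v h p → start ≤ h → h < start + fuel →
                     ∃ λ d → firstLen G S u v fuel start ≡ just d × d ≤ h
    path⇒firstLen≤ zero start P start≤h h< =
      ⊥-elim (ℕ.<⇒≱ h< (subst (_≤ _) (sym (ℕ.+-identityʳ start)) start≤h))
    path⇒firstLen≤ (suc fuel) start {h} {p} P start≤h h< with hasSPath? G S u v start
    ... | yes _ = start , refl , start≤h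
    ... | no ¬P with ℕ.m≤n⇒m<n∨m≡n start≤h
    ...   | inj₁ start<h =
      path⇒firstLen≤ fuel (suc start) {p = p} P start<h (subst (h <_) (ℕ.+-suc start fuel) h<)
    ...   | inj₂ refl    = ⊥-elim (¬P (p , P))

    ¬path⇒firstLen≡nothing : (∀ d p → ¬ IsSPath G S u v d p) →
                             ∀ fuel start → firstLen G S u v fuel start ≡ nothing
    ¬path⇒firstLen≡nothing ¬P zero       start = refl
    ¬path⇒firstLen≡nothing ¬P (suc fuel) start with hasSPath? G S u v start
    ... | yes (p , P) = ⊥-elim (¬P start p P)
    ... | no _        = ¬path⇒firstLen≡nothing ¬P fuel (suc start)

  dist≡just⇒path : ∀ {d} → dist G S u v ≡ just d → ∃ (IsSPath G S u v d) × d ≤ n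
  dist≡just⇒path eq = let (P , d<) = firstLen≡just⇒path (suc n) 0 eq in P , ℕ.≤-pred d<

  path⇒dist≤ : ∀ {h} → ∃ (IsSPath G S u v h) → ∃ λ d → dist G S u v ≡ just d × d ≤ h
  path⇒dist≤ (p , P@(_ , _ , injective , _)) =
    path⇒firstLen≤ (suc n) 0 {p = p} P z≤n (ℕ.m≤n⇒m≤1+n (injective⇒≤ {f = lookup p} (injective _ _)))

  ¬path⇒dist≡nothing : (∀ d p → ¬ IsSPath G S u v d p) → dist G S u v ≡ nothing
  ¬path⇒dist≡nothing ¬P = ¬path⇒firstLen≡nothing ¬P (suc n) 0

module ℚ-Mult = SemiringMult (CommutativeRing.semiring ℚ.+-*-commutativeRing)

ofℕ : ℕ → ℚ
ofℕ m = m ℚ-Mult.× 1ℚ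

ofℕ-nonNeg : ∀ m → 0ℚ ≤ℚ ofℕ m
ofℕ-nonNeg zero    = ℚ.≤-refl
ofℕ-nonNeg (suc m) = ℚ.+-mono-≤ (ℚ.nonNegative⁻¹ 1ℚ) (ofℕ-nonNeg m)

ofℕ-mono-≤ : ∀ {m k} → m ≤ k → ofℕ m ≤ℚ ofℕ k
ofℕ-mono-≤ {k = k} z≤n = ofℕ-nonNeg k
ofℕ-mono-≤ (s≤s m≤k)   = ℚ.+-monoʳ-≤ 1ℚ (ofℕ-mono-≤ m≤k)

ofℕ-mono-< : ∀ {m k} → m < k → ofℕ m <ℚ ofℕ k
ofℕ-mono-< {m} m<k =
  ℚ.<-≤-trans (subst (_<ℚ ofℕ (suc m)) (ℚ.+-identityˡ (ofℕ m))
                     (ℚ.+-mono-<-≤ (ℚ.positive⁻¹ 1ℚ) (ℚ.≤-refl {ofℕ m})))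
              (ofℕ-mono-≤ m<k)

ofℕ-cancel-≤ : ∀ {m k} → ofℕ m ≤ℚ ofℕ k → m ≤ k
ofℕ-cancel-≤ le = ℕ.≮⇒≥ λ k<m → ℚ.<-irrefl refl (ℚ.<-≤-trans (ofℕ-mono-< k<m) le)

^ℚ-+ : ∀ (q : ℚ) a {b} → q ^ℚ (a + b) ≡ (q ^ℚ a) *ℚ (q ^ℚ b)
^ℚ-+ q zero    = sym (ℚ.*-identityˡ _)
^ℚ-+ q (suc a) = trans (cong (q *ℚ_) (^ℚ-+ q a)) (sym (ℚ.*-assoc q _ _))

-- A vertex at distance d contributes 2 ^ (E ∸ d) = 2^(E-1) · 2(½)^d; the subtraction is exact as d ≤ n < E.
scaledTerm : ℕ → Bool → Maybe ℕ → ℕ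
scaledTerm E true  (just d) = 2 ^ (E ∸ d)
scaledTerm E true  nothing  = 0
scaledTerm E false _        = 0

scaledWeight : ∀ {n} → Graph n → VSet n → Fin n → ℕ
scaledWeight {n} G S u = sum λ v → scaledTerm (suc n) (S v) (dist G S u v)

½^-positive : ∀ m → Positive (½ ^ℚ m)
½^-positive zero    = _
½^-positive (suc m) = ℚ.pos*pos⇒pos ½ (½ ^ℚ m) {{½^-positive m}}

2^m*½^m≡1 : ∀ m → ofℕ (2 ^ m) *ℚ (½ ^ℚ m) ≡ 1ℚ
2^m*½^m≡1 zero    = refl
2^m*½^m≡1 (suc m) = begin
  ofℕ (2 * 2 ^ m) *ℚ (½ *ℚ (½ ^ℚ m))       ≡⟨ cong (_*ℚ (½ *ℚ (½ ^ℚ m))) (ℚ-Mult.×1-homo-* 2 (2 ^ m)) ⟩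
  (ofℕ 2 *ℚ ofℕ (2 ^ m)) *ℚ (½ *ℚ (½ ^ℚ m)) ≡⟨ solve 4 (λ a b c d → (a ⊕ b) ⊕ (c ⊕ d) ⊜ (a ⊕ c) ⊕ (b ⊕ d)) refl
                                                    (ofℕ 2) (ofℕ (2 ^ m)) ½ (½ ^ℚ m) ⟩
  (ofℕ 2 *ℚ ½) *ℚ (ofℕ (2 ^ m) *ℚ (½ ^ℚ m)) ≡⟨ cong ((ofℕ 2 *ℚ ½) *ℚ_) (2^m*½^m≡1 m) ⟩
  1ℚ                                          ∎
  where open ≡-Reasoning
        open CommutativeMonoidSolver ℚ.*-1-commutativeMonoid

halfPowPred-rescale : ∀ {d E} → d ≤ E → halfPowPred (just d) ≡ ofℕ (2 ^ (E ∸ d)) *ℚ halfPowPred (just E)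
halfPowPred-rescale {d} {E} d≤E = sym (begin
  ofℕ (2 ^ m) *ℚ (2ℚ *ℚ (½ ^ℚ E))
    ≡⟨ cong (λ k → ofℕ (2 ^ m) *ℚ (2ℚ *ℚ (½ ^ℚ k))) (sym (ℕ.m∸n+n≡m d≤E)) ⟩
  ofℕ (2 ^ m) *ℚ (2ℚ *ℚ (½ ^ℚ (m + d)))
    ≡⟨ cong (λ q → ofℕ (2 ^ m) *ℚ (2ℚ *ℚ q)) (^ℚ-+ ½ m) ⟩
  ofℕ (2 ^ m) *ℚ (2ℚ *ℚ ((½ ^ℚ m) *ℚ (½ ^ℚ d)))
    ≡⟨ solve 4 (λ a b c e → a ⊕ (e ⊕ (b ⊕ c)) ⊜ (a ⊕ b) ⊕ (e ⊕ c)) refl (ofℕ (2 ^ m)) (½ ^ℚ m) (½ ^ℚ d) 2ℚ ⟩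
  (ofℕ (2 ^ m) *ℚ (½ ^ℚ m)) *ℚ (2ℚ *ℚ (½ ^ℚ d))
    ≡⟨ cong (_*ℚ (2ℚ *ℚ (½ ^ℚ d))) (2^m*½^m≡1 m) ⟩
  1ℚ *ℚ (2ℚ *ℚ (½ ^ℚ d))
    ≡⟨ ℚ.*-identityˡ _ ⟩
  2ℚ *ℚ (½ ^ℚ d)
    ∎)
  where open ≡-Reasoning
        open CommutativeMonoidSolver ℚ.*-1-commutativeMonoid
        m = E ∸ d

foldrℚ-scaled : ∀ {n} (f : Fin n → ℚ) (a : Fin n → ℕ) c → (∀ i → f i ≡ ofℕ (a i) *ℚ c) →
                Vector.foldr _+ℚ_ 0ℚ f ≡ ofℕ (sum a) *ℚ c
foldrℚ-scaled {zero}  f a c f≡ = sym (ℚ.*-zeroˡ c)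
foldrℚ-scaled {suc n} f a c f≡ = begin
  f zero +ℚ Vector.foldr _+ℚ_ 0ℚ (f ∘ suc)     ≡⟨ cong₂ _+ℚ_ (f≡ zero)
                                                         (foldrℚ-scaled (f ∘ suc) (a ∘ suc) c (f≡ ∘ suc)) ⟩
  ofℕ (a zero) *ℚ c +ℚ ofℕ (sum (a ∘ suc)) *ℚ c ≡⟨ sym (ℚ.*-distribʳ-+ c (ofℕ (a zero)) _) ⟩
  (ofℕ (a zero) +ℚ ofℕ (sum (a ∘ suc))) *ℚ c    ≡⟨ cong (_*ℚ c) (sym (ℚ-Mult.×-homo-+ 1ℚ (a zero) _)) ⟩
  ofℕ (sum a) *ℚ c                              ∎
  where open ≡-Reasoning

weight≡scaledWeight : ∀ {n} (G : Graph n) S u →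
                      weight G S u ≡ ofℕ (scaledWeight G S u) *ℚ halfPowPred (just (suc n))
weight≡scaledWeight {n} G S u = trans (foldr-allFin _+ℚ_ 0ℚ term) (foldrℚ-scaled term _ _ term≡)
  where
  term : Fin n → ℚ
  term v = if S v then halfPowPred (dist G S u v) else 0ℚ
  term≡ : ∀ v → term v ≡ ofℕ (scaledTerm (suc n) (S v) (dist G S u v)) *ℚ halfPowPred (just (suc n))
  term≡ v = rescale (S v) refl
    where
    rescale : ∀ b {m} → dist G S u v ≡ m →
              (if b then halfPowPred m else 0ℚ) ≡ ofℕ (scaledTerm (suc n) b m) *ℚ halfPowPred (just (suc n))
    rescale false             _  = sym (ℚ.*-zeroˡ (halfPowPred (just (suc n))))
    rescale true  {nothing}   _  = sym (ℚ.*-zeroˡ (halfPowPred (just (suc n))))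
    rescale true  {just d}    eq = halfPowPred-rescale (ℕ.m≤n⇒m≤1+n (proj₂ (dist≡just⇒path G S u v eq)))

weight-bound : ∀ {n} (G : Graph n) S u → scaledWeight G S u ≤ 2 ^ suc n →
               (weight G S u ≤ℚ 2ℚ) × (weight G S u ≡ 2ℚ ⇔ scaledWeight G S u ≡ 2 ^ suc n)
weight-bound {n} G S u A≤ =
  subst₂ _≤ℚ_ (sym w≡) (sym 2≡) (ℚ.*-monoʳ-≤-nonNeg c {{ℚ.pos⇒nonNeg c}} (ofℕ-mono-≤ A≤)) , mk⇔ to from
  where
  c = halfPowPred (just (suc n))
  instance
    c-positive : Positive c
    c-positive = ℚ.pos*pos⇒pos 2ℚ (½ ^ℚ suc n) {{½^-positive (suc n)}}
  w≡ : weight G S u ≡ ofℕ (scaledWeight G S u) *ℚ c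
  w≡ = weight≡scaledWeight G S u
  2≡ : 2ℚ ≡ ofℕ (2 ^ suc n) *ℚ c
  2≡ = trans (sym (ℚ.*-identityʳ 2ℚ)) (halfPowPred-rescale {E = suc n} z≤n)
  to : weight G S u ≡ 2ℚ → scaledWeight G S u ≡ 2 ^ suc n
  to e = ℕ.≤-antisym A≤ (ofℕ-cancel-≤ (ℚ.*-cancelʳ-≤-pos c (subst₂ _≤ℚ_ 2≡ w≡ (ℚ.≤-reflexive (sym e)))))
  from : scaledWeight G S u ≡ 2 ^ suc n → weight G S u ≡ 2ℚ
  from e = trans w≡ (trans (cong (λ a → ofℕ a *ℚ c) e) (sym 2≡))

module Layers {n} (G : Graph n) (S : VSet n) (u : Fin n) where

  reach : ℕ → Fin n → Bool

  entered? : ∀ k y → Dec (∃ λ x → reach k x ∧ not (S x) ∧ adj G x y ≡ true)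
  entered? k y = any? λ x → reach k x ∧ not (S x) ∧ adj G x y ≟ᵇ true

  reach zero    y = does (y ≟ u)
  reach (suc k) y = reach k y ∨ does (entered? k y)

  layer : ℕ → Fin n → Bool
  layer zero    y = reach zero y
  layer (suc k) y = reach (suc k) y ∧ not (reach k y)

  active : ℕ → Fin n → Bool
  active k x = layer k x ∧ not (S x)

  child : ℕ → Fin n → Fin n → Bool
  child k x y = active k x ∧ adj G x y ∧ layer (suc k) y

  reach-suc : ∀ {k y} → reach k y ≡ true → reach (suc k) y ≡ true
  reach-suc e rewrite e = refl

  reach-mono : ∀ {j k y} → j ≤ k → reach j y ≡ true → reach k y ≡ true
  reach-mono {k = zero}  z≤n   e = e
  reach-mono {k = suc k} j≤1+k e with ℕ.m≤n⇒m<n∨m≡n j≤1+k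
  ... | inj₁ j<1+k = reach-suc {k} (reach-mono (ℕ.≤-pred j<1+k) e)
  ... | inj₂ refl  = e

  reach-extend : ∀ {k x y} → reach k x ≡ true → S x ≡ false → adj G x y ≡ true → reach (suc k) y ≡ true
  reach-extend {k} {x} {y} rx sx axy =
    trans (cong (reach k y ∨_) (dec-true (entered? k y) (x , cong₂ _∧_ rx (cong₂ _∧_ (cong not sx) axy))))
          (∨-zeroʳ (reach k y))

  layer⇒reach : ∀ {k y} → layer k y ≡ true → reach k y ≡ true
  layer⇒reach {zero}  e = e
  layer⇒reach {suc k} e = proj₁ (∧≡true⇒ e)

  layer-suc⇒¬reach : ∀ {k y} → layer (suc k) y ≡ true → reach k y ≡ false
  layer-suc⇒¬reach {k} {y} e = not-injective (proj₂ (∧≡true⇒ {reach (suc k) y} e))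

  reach⇒layer : ∀ {k y} → reach k y ≡ true → ∃ λ j → j ≤ k × layer j y ≡ true
  reach⇒layer {zero}  e = 0 , z≤n , e
  reach⇒layer {suc k} {y} e = earliest (reach k y) refl
    where
    earliest : ∀ b → reach k y ≡ b → ∃ λ j → j ≤ suc k × layer j y ≡ true
    earliest true  r = let (j , j≤k , lj) = reach⇒layer r in j , ℕ.m≤n⇒m≤1+n j≤k , lj
    earliest false r = suc k , ℕ.≤-refl , cong₂ _∧_ e (cong not r)

  layer-fresh : ∀ {j k y} → j ≤ k → layer j y ≡ true → layer (suc k) y ≢ true
  layer-fresh {j} {k} j≤k lj lk
    with () ← trans (sym (reach-mono j≤k (layer⇒reach {j} lj))) (layer-suc⇒¬reach {k} lk)

  layer-unique : ∀ {i j y} → layer i y ≡ true → layer j y ≡ true → i ≡ j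
  layer-unique {i} {j} li lj with ℕ.<-cmp i j
  ... | tri≈ _ i≡j _ = i≡j
  layer-unique {i}     {suc j} li lj | tri< i<j _ _ = ⊥-elim (layer-fresh (ℕ.≤-pred i<j) li lj)
  layer-unique {suc i} {j}     li lj | tri> _ _ j<i = ⊥-elim (layer-fresh (ℕ.≤-pred j<i) lj li)

  layer-parent : ∀ {k y} → layer (suc k) y ≡ true → ∃ λ x → active k x ≡ true × adj G x y ≡ true
  layer-parent {k} {y} ly = x , cong₂ _∧_ (subst (λ i → layer i x ≡ true) j≡k lj) ¬Sx , axy
    where
    ¬rk : reach k y ≡ false
    ¬rk = layer-suc⇒¬reach {k} ly
    entered = does≡true⇒ (entered? k y)
                (trans (cong (_∨ does (entered? k y)) (sym ¬rk)) (layer⇒reach {suc k} ly))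
    x = proj₁ entered
    rx : reach k x ≡ true
    rx = proj₁ (∧≡true⇒ (proj₂ entered))
    ¬Sx = proj₁ (∧≡true⇒ (proj₂ (∧≡true⇒ {reach k x} (proj₂ entered))))
    axy = proj₂ (∧≡true⇒ (proj₂ (∧≡true⇒ {reach k x} (proj₂ entered))))
    j = proj₁ (reach⇒layer {k} rx)
    lj : layer j x ≡ true
    lj = proj₂ (proj₂ (reach⇒layer {k} rx))
    j≡k : j ≡ k
    j≡k with ℕ.m≤n⇒m<n∨m≡n (proj₁ (proj₂ (reach⇒layer {k} rx)))
    ... | inj₂ j≡k = j≡k
    ... | inj₁ j<k
      with () ← trans (sym (reach-mono j<k (reach-extend {j} (layer⇒reach {j} lj) (not-injective ¬Sx) axy))) ¬rk

  path⇒reach : S u ≡ false → ∀ {v d} → ∃ (IsSPath G S u v d) → reach d v ≡ true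
  path⇒reach u∉S {v} {d} (p , p₀ , p-last , _ , p-adj , _ , _ , p-inner) =
    subst (λ z → reach d z ≡ true) p-last (prefix (fromℕ d) (toℕ-fromℕ d))
    where
    outside : ∀ (i : Fin d) → S (lookup p (inject₁ i)) ≡ false
    outside zero    = subst (λ z → S z ≡ false) (sym p₀) u∉S
    outside (suc i) = p-inner (inject₁ (suc i)) (λ ())
      (λ e → ℕ.<-irrefl (trans (cong suc (sym (toℕ-inject₁ i))) e) (toℕ<n (suc i)))
    prefix : ∀ (i : Fin (suc d)) {m} → toℕ i ≡ m → reach m (lookup p i) ≡ true
    prefix zero    {zero}  _ = subst (λ z → reach 0 z ≡ true) (sym p₀) (dec-true (u ≟ u) refl)
    prefix (suc i) {suc m} e =
      reach-extend {m} (prefix (inject₁ i) (trans (toℕ-inject₁ i) (ℕ.suc-injective e))) (outside i) (p-adj i)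

  layerSize settledSize activeSize parentEdges : ℕ → ℕ
  layerSize   k = sum (𝟙 ∘ layer k)
  settledSize k = sum λ y → 𝟙 (layer k y ∧ S y)
  activeSize  k = sum (𝟙 ∘ active k)
  parentEdges k = sum λ x → sum λ y → 𝟙 (child k x y)

  layerSize-split : ∀ k → layerSize k ≡ settledSize k + activeSize k
  layerSize-split k = sum-𝟙-split (layer k) S

  layer-suc≤parents : ∀ k y → 𝟙 (layer (suc k) y) ≤ sum λ x → 𝟙 (child k x y)
  layer-suc≤parents k y = parents (layer (suc k) y) refl
    where
    parents : ∀ b → layer (suc k) y ≡ b → 𝟙 b ≤ sum λ x → 𝟙 (child k x y)
    parents false _  = z≤n
    parents true  ly = let (x , ax , axy) = layer-parent {k} ly in
      subst (λ b → 𝟙 b ≤ sum λ x → 𝟙 (child k x y)) (cong₂ _∧_ ax (cong₂ _∧_ axy ly))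
            (≤-sum (λ x → 𝟙 (child k x y)) x)

  layerSize-suc≤parentEdges : ∀ k → layerSize (suc k) ≤ parentEdges k
  layerSize-suc≤parentEdges k = ℕ.≤-trans (sum-mono-≤ (layer-suc≤parents k))
                                          (ℕ.≤-reflexive (∑-comm (λ y x → 𝟙 (child k x y))))

module Branching {n} (G : Graph n) (S : VSet n) (u : Fin n)
                 (maxDeg≤3 : ∀ v → deg G v ≤ 3) (deg-u≤2 : deg G u ≤ 2) where
  open Layers G S u

  -- Beyond layer 0, the parent of x is a neighbour of x outside the next layer.
  children≤2 : ∀ {k x} → layer k x ≡ true → sum (λ y → 𝟙 (adj G x y ∧ layer (suc k) y)) ≤ 2
  children≤2 {zero} {x} lx = begin
    sum (λ y → 𝟙 (adj G x y ∧ layer 1 y)) ≤⟨ sum-mono-≤ (λ y → 𝟙-∧-≤ˡ (adj G x y) _) ⟩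
    sum (𝟙 ∘ adj G x)                     ≡⟨ sym (count≡sum (adj G x)) ⟩
    deg G x                               ≡⟨ cong (deg G) (does≡true⇒ (x ≟ u) lx) ⟩
    deg G u                               ≤⟨ deg-u≤2 ⟩
    2                                     ∎
    where open ℕ.≤-Reasoning
  children≤2 {suc k} {x} lx = ℕ.≤-pred (begin
    suc new            ≤⟨ ℕ.+-monoˡ-≤ new 1≤old ⟩
    old + new          ≡⟨ ℕ.+-comm old new ⟩
    new + old          ≡⟨ sym (sum-𝟙-split (adj G x) (layer (suc (suc k)))) ⟩
    sum (𝟙 ∘ adj G x)  ≡⟨ sym (count≡sum (adj G x)) ⟩
    deg G x            ≤⟨ maxDeg≤3 x ⟩
    3                  ∎)
    where
    open ℕ.≤-Reasoning
    new old : ℕ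
    new = sum λ y → 𝟙 (adj G x y ∧ layer (suc (suc k)) y)
    old = sum λ y → 𝟙 (adj G x y ∧ not (layer (suc (suc k)) y))
    parent = layer-parent {k} lx
    p = proj₁ parent
    p-old : layer (suc (suc k)) p ≡ false
    p-old = ¬-not (layer-fresh (ℕ.n≤1+n k) (proj₁ (∧≡true⇒ (proj₁ (proj₂ parent)))))
    1≤old : 1 ≤ old
    1≤old = subst (λ b → 𝟙 b ≤ old)
                  (cong₂ _∧_ (trans (Graph.sym G x p) (proj₂ (proj₂ parent))) (cong not p-old))
                  (≤-sum (λ y → 𝟙 (adj G x y ∧ not (layer (suc (suc k)) y))) p)

  children≤2·active : ∀ k x → sum (λ y → 𝟙 (child k x y)) ≤ 𝟙 (active k x) * 2
  children≤2·active k x = bound (active k x) refl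
    where
    bound : ∀ b → active k x ≡ b → sum (λ y → 𝟙 (b ∧ adj G x y ∧ layer (suc k) y)) ≤ 𝟙 b * 2
    bound false _  = ℕ.≤-reflexive (sum-replicate-zero n)
    bound true  ax = children≤2 {k} (proj₁ (∧≡true⇒ ax))

  parentEdges≤2·activeSize : ∀ k → parentEdges k ≤ activeSize k * 2
  parentEdges≤2·activeSize k = ℕ.≤-trans (sum-mono-≤ (children≤2·active k))
                                         (ℕ.≤-reflexive (sym (*-distribʳ-sum 2 (𝟙 ∘ active k))))

  branching : ∀ k → settledSize (suc k) + activeSize (suc k) ≤ activeSize k * 2
  branching k = subst (_≤ activeSize k * 2) (layerSize-split (suc k))
                      (ℕ.≤-trans (layerSize-suc≤parentEdges k) (parentEdges≤2·activeSize k))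

-- σ k and τ k count the settled and the still active members of generation k.
module Potential (E : ℕ) (σ τ : ℕ → ℕ) (branching : ∀ k → σ (suc k) + τ (suc k) ≤ τ k * 2) where

  settled : ℕ → ℕ
  settled zero    = 0
  settled (suc k) = settled k + σ k * 2 ^ (E ∸ k)

  Φ : ℕ → ℕ
  Φ k = settled k + (σ k + τ k) * 2 ^ (E ∸ k)

  private
    Φ-unfold : ∀ {k} → k < E → Φ k ≡ settled (suc k) + (τ k * 2) * 2 ^ (E ∸ suc k)
    Φ-unfold {k} k<E = unfold (2 ^ (E ∸ k)) (cong (2 ^_) (ℕ.+-∸-assoc 1 k<E))
      where
      open +-*-Solver
      unfold : ∀ y → y ≡ 2 * 2 ^ (E ∸ suc k) →
               settled k + (σ k + τ k) * y ≡ (settled k + σ k * y) + (τ k * 2) * 2 ^ (E ∸ suc k)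
      unfold _ refl = solve 4 (λ a s t x → a :+ (s :+ t) :* (con 2 :* x)
                                        := (a :+ s :* (con 2 :* x)) :+ (t :* con 2) :* x)
                              refl (settled k) (σ k) (τ k) (2 ^ (E ∸ suc k))

  Φ-step : ∀ {k} → k < E → Φ (suc k) ≤ Φ k
  Φ-step {k} k<E = ℕ.≤-trans (ℕ.+-monoʳ-≤ (settled (suc k)) (ℕ.*-monoˡ-≤ (2 ^ (E ∸ suc k)) (branching k)))
                             (ℕ.≤-reflexive (sym (Φ-unfold k<E)))

  Φ-step-≡ : ∀ {k} → k < E → Φ (suc k) ≡ Φ k → σ (suc k) + τ (suc k) ≡ τ k * 2
  Φ-step-≡ {k} k<E eq =
    ℕ.*-cancelʳ-≡ _ _ (2 ^ (E ∸ suc k)) {{ℕ.m^n≢0 2 (E ∸ suc k)}}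
      (ℕ.+-cancelˡ-≡ (settled (suc k)) _ _ (trans eq (Φ-unfold k<E)))

  Φ-antitone : ∀ {j k} → j ≤ k → k ≤ E → Φ k ≤ Φ j
  Φ-antitone {k = zero}  z≤n   _     = ℕ.≤-refl
  Φ-antitone {k = suc k} j≤1+k 1+k≤E with ℕ.m≤n⇒m<n∨m≡n j≤1+k
  ... | inj₁ j<1+k = ℕ.≤-trans (Φ-step 1+k≤E) (Φ-antitone (ℕ.≤-pred j<1+k) (ℕ.<⇒≤ 1+k≤E))
  ... | inj₂ refl  = ℕ.≤-refl

  settled≤Φ₀ : settled E ≤ Φ 0
  settled≤Φ₀ = ℕ.≤-trans (ℕ.m≤m+n (settled E) _) (Φ-antitone z≤n ℕ.≤-refl)

  module Tight (tight : Φ 0 ≤ settled E) where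

    Φ-constant : ∀ {k} → k < E → Φ (suc k) ≡ Φ k
    Φ-constant {k} k<E = ℕ.≤-antisym (Φ-step k<E) (begin
      Φ k        ≤⟨ Φ-antitone z≤n (ℕ.<⇒≤ k<E) ⟩
      Φ 0        ≤⟨ tight ⟩
      settled E  ≤⟨ ℕ.m≤m+n (settled E) _ ⟩
      Φ E        ≤⟨ Φ-antitone k<E ℕ.≤-refl ⟩
      Φ (suc k)  ∎)
      where open ℕ.≤-Reasoning

    saturated : ∀ {k} → k < E → σ (suc k) + τ (suc k) ≡ τ k * 2
    saturated k<E = Φ-step-≡ k<E (Φ-constant k<E)

    extinct : σ E + τ E ≡ 0
    extinct = ℕ.n≤0⇒n≡0 (ℕ.+-cancelˡ-≤ (settled E) _ 0 (begin
      settled E + (σ E + τ E)            ≡⟨ cong (λ m → settled E + m) (sym (ℕ.*-identityʳ _)) ⟩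
      settled E + (σ E + τ E) * 2 ^ 0    ≡⟨ cong (λ e → settled E + (σ E + τ E) * 2 ^ e) (sym (ℕ.n∸n≡0 E)) ⟩
      Φ E                                ≤⟨ Φ-antitone z≤n ℕ.≤-refl ⟩
      Φ 0                                ≤⟨ tight ⟩
      settled E                          ≡⟨ sym (ℕ.+-identityʳ _) ⟩
      settled E + 0                      ∎))
      where open ℕ.≤-Reasoning

IsGood : ∀ {n} {G : Graph n} (S : VSet n) {r} → FBT G r → Set
IsGood S T = Unique (vertices T) × All (λ y → S y ≡ true) (leaves T) × All (λ y → S y ≡ false) (internals T)

module Exploration {n} (G : Graph n) (S : VSet n) (u : Fin n) (u∉S : S u ≡ false)
                   (maxDeg≤3 : ∀ v → deg G v ≤ 3) (deg-u≤2 : deg G u ≤ 2) where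
  open Layers G S u
  open Branching G S u maxDeg≤3 deg-u≤2

  E : ℕ
  E = suc n

  open Potential E settledSize activeSize branching

  Φ₀≡2^E : Φ 0 ≡ 2 ^ E
  Φ₀≡2^E = trans (cong (_* 2 ^ E) (trans (sym (layerSize-split 0)) (sum-point u 1))) (ℕ.*-identityˡ (2 ^ E))

  settledAt : ℕ → Fin n → ℕ
  settledAt zero    v = 0
  settledAt (suc k) v = settledAt k v + 𝟙 (layer k v ∧ S v) * 2 ^ (E ∸ k)

  settled≡sum-settledAt : ∀ k → settled k ≡ sum (settledAt k)
  settled≡sum-settledAt zero    = sym (sum-replicate-zero n)
  settled≡sum-settledAt (suc k) =
    trans (cong₂ _+_ (settled≡sum-settledAt k) (*-distribʳ-sum (2 ^ (E ∸ k)) (λ v → 𝟙 (layer k v ∧ S v))))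
          (sym (∑-distrib-+ (settledAt k) (λ v → 𝟙 (layer k v ∧ S v) * 2 ^ (E ∸ k))))

  settledAt-≥ : ∀ {j k} v → j < k → 𝟙 (layer j v ∧ S v) * 2 ^ (E ∸ j) ≤ settledAt k v
  settledAt-≥ {j} {suc k} v j<1+k with ℕ.m≤n⇒m<n∨m≡n (ℕ.≤-pred j<1+k)
  ... | inj₁ j<k  = ℕ.≤-trans (settledAt-≥ v j<k) (ℕ.m≤m+n _ _)
  ... | inj₂ refl = ℕ.m≤n+m _ _

  scaledTerm≤settledAt : ∀ v → scaledTerm E (S v) (dist G S u v) ≤ settledAt E v
  scaledTerm≤settledAt v = bound (S v) refl refl
    where
    bound : ∀ b {m} → S v ≡ b → dist G S u v ≡ m → scaledTerm E b m ≤ settledAt E v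
    bound false            _   _  = z≤n
    bound true  {nothing}  _   _  = z≤n
    bound true  {just d}   v∈S eq = begin
      2 ^ (E ∸ d)                           ≤⟨ ℕ.^-monoʳ-≤ 2 (ℕ.∸-monoʳ-≤ E j≤d) ⟩
      2 ^ (E ∸ j)                           ≡⟨ sym (trans (cong (λ b → 𝟙 b * 2 ^ (E ∸ j)) (cong₂ _∧_ lj v∈S))
                                                          (ℕ.*-identityˡ _)) ⟩
      𝟙 (layer j v ∧ S v) * 2 ^ (E ∸ j)     ≤⟨ settledAt-≥ v (s≤s (ℕ.≤-trans j≤d d≤n)) ⟩
      settledAt E v                         ∎
      where
      open ℕ.≤-Reasoning
      path = dist≡just⇒path G S u v eq
      d≤n = proj₂ path
      earliest = reach⇒layer {d} (path⇒reach u∉S (proj₁ path))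
      j = proj₁ earliest
      j≤d = proj₁ (proj₂ earliest)
      lj = proj₂ (proj₂ earliest)

  scaledWeight≤settled : scaledWeight G S u ≤ settled E
  scaledWeight≤settled =
    ℕ.≤-trans (sum-mono-≤ scaledTerm≤settledAt) (ℕ.≤-reflexive (sym (settled≡sum-settledAt E)))

  scaledWeight-≤ : scaledWeight G S u ≤ 2 ^ E
  scaledWeight-≤ = ℕ.≤-trans scaledWeight≤settled (subst (settled E ≤_) Φ₀≡2^E settled≤Φ₀)

  module Extremal (extremal : scaledWeight G S u ≡ 2 ^ E) where
    open Tight (subst (_≤ settled E) (trans extremal (sym Φ₀≡2^E)) scaledWeight≤settled)

    layerSize-suc≡2·activeSize : ∀ {k} → k < E → layerSize (suc k) ≡ activeSize k * 2
    layerSize-suc≡2·activeSize {k} k<E = trans (layerSize-split (suc k)) (saturated k<E)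

    one-parent : ∀ {k} → k < E → ∀ y → 𝟙 (layer (suc k) y) ≡ sum λ x → 𝟙 (child k x y)
    one-parent {k} k<E = pointwise-≤∧sum-≡⇒≡ (layer-suc≤parents k)
      (ℕ.≤-antisym (sum-mono-≤ (layer-suc≤parents k)) (begin
        sum (λ y → sum λ x → 𝟙 (child k x y)) ≡⟨ ∑-comm (λ y x → 𝟙 (child k x y)) ⟩
        parentEdges k                         ≤⟨ parentEdges≤2·activeSize k ⟩
        activeSize k * 2                      ≡⟨ sym (layerSize-suc≡2·activeSize k<E) ⟩
        layerSize (suc k)                     ∎))
      where open ℕ.≤-Reasoning

    two-children : ∀ {k} → k < E → ∀ x → sum (λ y → 𝟙 (child k x y)) ≡ 𝟙 (active k x) * 2
    two-children {k} k<E = pointwise-≤∧sum-≡⇒≡ (children≤2·active k)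
      (ℕ.≤-antisym (sum-mono-≤ (children≤2·active k)) (begin
        sum (λ x → 𝟙 (active k x) * 2) ≡⟨ sym (*-distribʳ-sum 2 (𝟙 ∘ active k)) ⟩
        activeSize k * 2               ≡⟨ sym (layerSize-suc≡2·activeSize k<E) ⟩
        layerSize (suc k)              ≤⟨ layerSize-suc≤parentEdges k ⟩
        parentEdges k                  ∎))
      where open ℕ.≤-Reasoning

    child⇒layer : ∀ {k x y} → child k x y ≡ true → layer (suc k) y ≡ true
    child⇒layer {k} {x} c = proj₂ (∧≡true⇒ {adj G x _} (proj₂ (∧≡true⇒ {active k x} c)))

    parent-unique : ∀ {k p p′ y} → k < E → child k p y ≡ true → child k p′ y ≡ true → p ≡ p′
    parent-unique {k} {y = y} k<E c c′ =
      sum-𝟙≤1⇒unique (λ x → child k x y)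
        (ℕ.≤-reflexive (trans (sym (one-parent k<E y)) (cong 𝟙 (child⇒layer {k} c)))) c c′

    children-pair : ∀ {k x} → k < E → active k x ≡ true →
                    ∃₂ λ a b → a ≢ b × child k x a ≡ true × child k x b ≡ true
    children-pair {k} {x} k<E ax =
      sum-𝟙≥2⇒∃₂ (child k x) (ℕ.≤-reflexive (sym (trans (two-children k<E x) (cong (λ b → 𝟙 b * 2) ax))))

    last-layer-empty : ∀ y → layer E y ≢ true
    last-layer-empty y ly = ℕ.1+n≰n (begin
      1                ≡⟨ cong 𝟙 (sym ly) ⟩
      𝟙 (layer E y)    ≤⟨ ≤-sum (𝟙 ∘ layer E) y ⟩
      layerSize E      ≡⟨ trans (layerSize-split E) extinct ⟩
      0                ∎)
      where open ℕ.≤-Reasoning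

    data Descendant (k : ℕ) (x : Fin n) : ℕ → Fin n → Set where
      self : Descendant k x k x
      step : ∀ {j p y} → Descendant k x j p → j < E → child j p y ≡ true → Descendant k x (suc j) y

    descendant-layer : ∀ {k x j y} → layer k x ≡ true → Descendant k x j y → layer j y ≡ true
    descendant-layer lx self                  = lx
    descendant-layer lx (step {j} _ _ c)      = child⇒layer {j} c

    descendant-≤ : ∀ {k x j y} → Descendant k x j y → k ≤ j
    descendant-≤ self           = ℕ.≤-refl
    descendant-≤ (step d _ _)   = ℕ.m≤n⇒m≤1+n (descendant-≤ d)

    descendant-unique : ∀ {k a b j y} → Descendant k a j y → Descendant k b j y → a ≡ b
    descendant-unique self           self             = refl
    descendant-unique self           (step d _ _)     = ⊥-elim (ℕ.1+n≰n (descendant-≤ d))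
    descendant-unique (step d _ _)   self             = ⊥-elim (ℕ.1+n≰n (descendant-≤ d))
    descendant-unique (step d j<E c) (step d′ _ c′) with parent-unique j<E c c′
    ... | refl = descendant-unique d d′

    descendant-lift : ∀ {k x a j y} → child k x a ≡ true → k < E → Descendant (suc k) a j y → Descendant k x j y
    descendant-lift c k<E self          = step self k<E c
    descendant-lift c k<E (step d j<E c′) = step (descendant-lift c k<E d) j<E c′

    Descends : ℕ → Fin n → Fin n → Set
    Descends k x y = ∃ λ j → Descendant k x j y

    Subtree : ℕ → Fin n → Set
    Subtree k x = Σ (FBT G x) λ T → IsGood S T × All (Descends k x) (vertices T)

    join : ∀ {k x a b} → layer k x ≡ true → S x ≡ false → k < E → a ≢ b →
           child k x a ≡ true → child k x b ≡ true → Subtree (suc k) a → Subtree (suc k) b → Subtree k x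
    join {k} {x} {a} {b} lx x∉S k<E a≢b ca cb (Ta , (uA , lA , iA) , dA) (Tb , (uB , lB , iB) , dB) =
      node a b (edge ca) (edge cb) Ta Tb ,
      (All.++⁺ (All.map (ancestor≢ ca) dA) (All.map (ancestor≢ cb) dB) ∷ Unique.++⁺ uA uB disjoint ,
       All.++⁺ lA lB , x∉S ∷ All.++⁺ iA iB) ,
      (k , self) ∷ All.++⁺ (All.map (lift ca) dA) (All.map (lift cb) dB)
      where
      edge : ∀ {c} → child k x c ≡ true → adj G x c ≡ true
      edge {c} cc = proj₁ (∧≡true⇒ {adj G x c} (proj₂ (∧≡true⇒ {active k x} cc)))
      ancestor≢ : ∀ {c y} → child k x c ≡ true → Descends (suc k) c y → x ≢ y
      ancestor≢ {c} cc (j , d) refl =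
        ℕ.1+n≰n (subst (suc k ≤_) (sym (layer-unique lx (descendant-layer (child⇒layer {k} cc) d)))
                       (descendant-≤ d))
      lift : ∀ {c y} → child k x c ≡ true → Descends (suc k) c y → Descends k x y
      lift cc (j , d) = j , descendant-lift cc k<E d
      disjoint : Disjoint (vertices Ta) (vertices Tb)
      disjoint (y∈A , y∈B) with All.lookup dA y∈A | All.lookup dB y∈B
      ... | j , d | j′ , d′ with layer-unique {j} {j′} (descendant-layer (child⇒layer {k} ca) d)
                                              (descendant-layer (child⇒layer {k} cb) d′)
      ...   | refl = a≢b (descendant-unique d d′)

    subtree : ∀ m {k x} → m + k ≡ E → layer k x ≡ true → Subtree k x
    subtree zero    refl lx = ⊥-elim (last-layer-empty _ lx)
    subtree (suc m) {k} {x} m+k≡E lx with S x in x∈S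
    ... | true  = leaf , (([] ∷ []) , (x∈S ∷ []) , []) , ((k , self) ∷ [])
    ... | false =
      let (a , b , a≢b , ca , cb) = children-pair k<E (cong₂ _∧_ lx (cong not x∈S)) in
      join lx x∈S k<E a≢b ca cb (subtree m (trans (ℕ.+-suc m k) m+k≡E) (child⇒layer {k} ca))
                               (subtree m (trans (ℕ.+-suc m k) m+k≡E) (child⇒layer {k} cb))
      where
      k<E : k < E
      k<E = subst (k <_) m+k≡E (s≤s (ℕ.m≤n+m k m))

    goodTree : GoodTree G S u
    goodTree = let (T , good , _) = subtree E (ℕ.+-identityʳ E) (dec-true (u ≟ u) refl) in T , good

Unique-++⁻ : ∀ {A : Set} (xs : List A) {ys} → Unique (xs ++ ys) → Unique xs × Unique ys × Disjoint xs ys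
Unique-++⁻ []       u           = [] , u , λ ()
Unique-++⁻ (x ∷ xs) (x∉ ∷ rest) =
  let (uxs , uys , disjoint) = Unique-++⁻ xs rest in
  (All.++⁻ˡ xs x∉ ∷ uxs) , uys ,
  λ { (here refl , y∈ys) → All.lookup (All.++⁻ʳ xs x∉) y∈ys refl
    ; (there y∈xs , y∈ys) → disjoint (y∈xs , y∈ys) }

module TreePaths {n} (G : Graph n) (S : VSet n) where

  TreePath : Fin n → Fin n → ℕ → List (Fin n) → Set
  TreePath r v h W = Σ (Vec (Fin n) (suc h)) λ p →
      (lookup p zero ≡ r) × (lookup p (fromℕ h) ≡ v) × (∀ i j → lookup p i ≡ lookup p j → i ≡ j) ×
      (∀ (i : Fin h) → adj G (lookup p (inject₁ i)) (lookup p (suc i)) ≡ true) ×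
      (∀ i → toℕ i ≢ h → S (lookup p i) ≡ false) × (∀ i → lookup p i ∈ W)

  trivialPath : ∀ {r W} → r ∈ W → TreePath r r 0 W
  trivialPath r∈W = (_ ∷ []) , refl , refl , (λ { zero zero _ → refl }) , (λ ()) ,
                    (λ { zero 0≢0 → ⊥-elim (0≢0 refl) }) , (λ { zero → r∈W })

  consPath : ∀ {r a v h W W′} → adj G r a ≡ true → S r ≡ false → r ∉ W → (∀ {w} → w ∈ W → w ∈ W′) → r ∈ W′ →
             TreePath a v h W → TreePath r v (suc h) W′
  consPath {r} {h = h} ra r∉S r∉W W⊆W′ r∈W′ (p , p₀ , p-last , injective , p-adj , p-outside , p∈W) =
    (r ∷ p) , refl , p-last , injective′ , adj′ , outside′ , (λ { zero → r∈W′ ; (suc i) → W⊆W′ (p∈W i) })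
    where
    injective′ : ∀ i j → lookup (r ∷ p) i ≡ lookup (r ∷ p) j → i ≡ j
    injective′ zero    zero    _ = refl
    injective′ zero    (suc j) e = ⊥-elim (r∉W (subst (_∈ _) (sym e) (p∈W j)))
    injective′ (suc i) zero    e = ⊥-elim (r∉W (subst (_∈ _) e (p∈W i)))
    injective′ (suc i) (suc j) e = cong suc (injective i j e)
    adj′ : ∀ (i : Fin (suc h)) → adj G (lookup (r ∷ p) (inject₁ i)) (lookup (r ∷ p) (suc i)) ≡ true
    adj′ zero    = subst (λ z → adj G r z ≡ true) (sym p₀) ra
    adj′ (suc i) = p-adj i
    outside′ : ∀ i → toℕ i ≢ suc h → S (lookup (r ∷ p) i) ≡ false
    outside′ zero    _   = r∉S
    outside′ (suc i) i≢h = p-outside i (i≢h ∘ cong suc)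

  endpoint∈ : ∀ {r v h W} → TreePath r v h W → v ∈ W
  endpoint∈ {h = h} (p , _ , p-last , _ , _ , _ , p∈W) = subst (_∈ _) p-last (p∈W (fromℕ h))

  TreePath-length : ∀ {r v h W} → TreePath r v h W → suc h ≤ n
  TreePath-length (p , _ , _ , injective , _) = injective⇒≤ {f = lookup p} (injective _ _)

  TreePath⇒SPath : ∀ {u v h W} → S u ≡ false → S v ≡ true → (P : TreePath u v h W) → IsSPath G S u v h (proj₁ P)
  TreePath⇒SPath {u} {v} u∉S v∈S (p , p₀ , p-last , injective , p-adj , p-outside , _) =
    p₀ , p-last , injective , p-adj , trans (cong (S u ∨_) v∈S) (∨-zeroʳ (S u)) , one-endpoint ,
    λ i _ i≢h → p-outside i i≢h
    where
    one-endpoint : S u ∧ S v ≡ true → u ≡ v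
    one-endpoint both with () ← trans (sym (cong (_∧ S v) u∉S)) both

  IsGood-node⁻ : ∀ {r a b ra rb} {Ta : FBT G a} {Tb : FBT G b} → IsGood S (node {r = r} a b ra rb Ta Tb) →
                 IsGood S Ta × IsGood S Tb × S r ≡ false × r ∉ vertices Ta × r ∉ vertices Tb ×
                 Disjoint (vertices Ta) (vertices Tb)
  IsGood-node⁻ {Ta = Ta} (r∉Ta++Tb ∷ uTaTb , leavesS , r∉S ∷ internalsS) =
    let (uA , uB , disjoint) = Unique-++⁻ (vertices Ta) uTaTb
        (lA , lB) = All.++⁻ (leaves Ta) leavesS
        (iA , iB) = All.++⁻ (internals Ta) internalsS
    in (uA , lA , iA) , (uB , lB , iB) , r∉S ,
       (λ r∈A → All.lookup r∉Ta++Tb (∈-++⁺ˡ r∈A) refl) ,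
       (λ r∈B → All.lookup r∉Ta++Tb (∈-++⁺ʳ (vertices Ta) r∈B) refl) , disjoint

  -- A leaf at depth h carries 2 ^ (N ∸ h).
  kraftWeight : ∀ {r} → FBT G r → ℕ → Fin n → ℕ
  kraftWeight {r} leaf                 N = point r (2 ^ N)
  kraftWeight     (node _ _ _ _ Ta Tb) N v = kraftWeight Ta (N ∸ 1) v + kraftWeight Tb (N ∸ 1) v

  height : ∀ {r} → FBT G r → ℕ
  height leaf                 = 0
  height (node _ _ _ _ Ta Tb) = suc (height Ta ⊔ height Tb)

  kraft : ∀ {r} (T : FBT G r) {N} → height T ≤ N → sum (kraftWeight T N) ≡ 2 ^ N
  kraft {r} leaf {N} _ = sum-point r (2 ^ N)
  kraft (node _ _ _ _ Ta Tb) {suc N} (s≤s h≤N) = begin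
    sum (λ v → kraftWeight Ta N v + kraftWeight Tb N v)   ≡⟨ ∑-distrib-+ (kraftWeight Ta N) (kraftWeight Tb N) ⟩
    sum (kraftWeight Ta N) + sum (kraftWeight Tb N)       ≡⟨ cong₂ _+_ (kraft Ta (ℕ.≤-trans (ℕ.m≤m⊔n _ _) h≤N))
                                                                      (kraft Tb (ℕ.≤-trans (ℕ.m≤n⊔m _ _) h≤N)) ⟩
    2 ^ N + 2 ^ N                                         ≡⟨ cong (2 ^ N +_) (sym (ℕ.+-identityʳ (2 ^ N))) ⟩
    2 ^ suc N                                             ∎
    where open ≡-Reasoning

  kraftWeight-outside : ∀ {r} (T : FBT G r) N {v} → v ∉ vertices T → kraftWeight T N v ≡ 0
  kraftWeight-outside {r} leaf N {v} v∉ with v ≟ r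
  ... | yes v≡r = ⊥-elim (v∉ (here v≡r))
  ... | no  _   = refl
  kraftWeight-outside (node _ _ _ _ Ta Tb) N v∉ =
    cong₂ _+_ (kraftWeight-outside Ta (N ∸ 1) (v∉ ∘ there ∘ ∈-++⁺ˡ))
              (kraftWeight-outside Tb (N ∸ 1) (v∉ ∘ there ∘ ∈-++⁺ʳ (vertices Ta)))

  leafPath : ∀ {r} (T : FBT G r) → IsGood S T → ∀ N v →
             kraftWeight T N v ≡ 0 ⊎
             ∃ λ h → kraftWeight T N v ≡ 2 ^ (N ∸ h) × S v ≡ true × TreePath r v h (vertices T)
  leafPath {r} leaf (_ , r∈S ∷ [] , _) N v with v ≟ r
  ... | no  _    = inj₁ refl
  ... | yes refl = inj₂ (0 , refl , r∈S , trivialPath (here refl))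
  leafPath {r} (node a b ra rb Ta Tb) good N v with IsGood-node⁻ {ra = ra} {rb = rb} {Ta = Ta} {Tb = Tb} good
  ... | goodA , goodB , r∉S , r∉A , r∉B , disjoint
    with leafPath Ta goodA (N ∸ 1) v | leafPath Tb goodB (N ∸ 1) v
  ... | inj₁ wA | inj₁ wB = inj₁ (cong₂ _+_ wA wB)
  ... | inj₂ (h , wA , v∈S , path) | _ =
    inj₂ (suc h , trans (cong₂ _+_ wA (kraftWeight-outside Tb (N ∸ 1) λ v∈B → disjoint (endpoint∈ path , v∈B)))
                        (trans (ℕ.+-identityʳ _) (cong (2 ^_) (ℕ.∸-+-assoc N 1 h))) ,
          v∈S , consPath ra r∉S r∉A (there ∘ ∈-++⁺ˡ) (here refl) path)
  ... | inj₁ wA | inj₂ (h , wB , v∈S , path) =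
    inj₂ (suc h , trans (cong₂ _+_ wA wB) (cong (2 ^_) (ℕ.∸-+-assoc N 1 h)) ,
          v∈S , consPath rb r∉S r∉B (there ∘ ∈-++⁺ʳ (vertices Ta)) (here refl) path)

  deepestPath : ∀ {r} (T : FBT G r) → IsGood S T → ∃ λ v → TreePath r v (height T) (vertices T)
  deepestPath {r} leaf _ = r , trivialPath (here refl)
  deepestPath {r} (node a b ra rb Ta Tb) good
    with IsGood-node⁻ {ra = ra} {rb = rb} {Ta = Ta} {Tb = Tb} good | ℕ.≤-total (height Ta) (height Tb)
  ... | _ , goodB , r∉S , _ , r∉B , _ | inj₁ hA≤hB =
    let (v , path) = deepestPath Tb goodB in
    v , subst (λ h → TreePath r v (suc h) _) (sym (ℕ.m≤n⇒m⊔n≡n hA≤hB))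
              (consPath rb r∉S r∉B (there ∘ ∈-++⁺ʳ (vertices Ta)) (here refl) path)
  ... | goodA , _ , r∉S , r∉A , _ , _ | inj₂ hB≤hA =
    let (v , path) = deepestPath Ta goodA in
    v , subst (λ h → TreePath r v (suc h) _) (sym (ℕ.m≥n⇒m⊔n≡m hB≤hA))
              (consPath ra r∉S r∉A (there ∘ ∈-++⁺ˡ) (here refl) path)

  GoodTree⇒2^E≤scaledWeight : ∀ {u} → S u ≡ false → GoodTree G S u → 2 ^ suc n ≤ scaledWeight G S u
  GoodTree⇒2^E≤scaledWeight {u} u∉S (T , good) =
    subst (_≤ scaledWeight G S u) (kraft T height≤E) (sum-mono-≤ kraftWeight≤scaledTerm)
    where
    height≤E : height T ≤ suc n
    height≤E = ℕ.m≤n⇒m≤1+n (ℕ.<⇒≤ (TreePath-length (proj₂ (deepestPath T good))))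
    kraftWeight≤scaledTerm : ∀ v → kraftWeight T (suc n) v ≤ scaledTerm (suc n) (S v) (dist G S u v)
    kraftWeight≤scaledTerm v with leafPath T good (suc n) v
    ... | inj₁ w≡0 = subst (_≤ _) (sym w≡0) z≤n
    ... | inj₂ (h , w≡ , v∈S , path) = begin
      kraftWeight T (suc n) v                    ≡⟨ w≡ ⟩
      2 ^ (suc n ∸ h)                            ≤⟨ ℕ.^-monoʳ-≤ 2 (ℕ.∸-monoʳ-≤ (suc n) d≤h) ⟩
      2 ^ (suc n ∸ d)                            ≡⟨ sym (cong₂ (scaledTerm (suc n)) v∈S dist≡) ⟩
      scaledTerm (suc n) (S v) (dist G S u v)    ∎
      where
      open ℕ.≤-Reasoning
      shortest = path⇒dist≤ G S u v (proj₁ path , TreePath⇒SPath u∉S v∈S path)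
      d = proj₁ shortest
      dist≡ = proj₁ (proj₂ shortest)
      d≤h = proj₂ (proj₂ shortest)

module _ {n} (G : Graph n) (S : VSet n) {u : Fin n} (u∈S : S u ≡ true) where

  selfPath : IsSPath G S u u 0 (u ∷ [])
  selfPath = refl , refl , (λ { zero zero _ → refl }) , (λ ()) , trans (cong (_∨ S u) u∈S) refl ,
             (λ _ → refl) , (λ { zero 0≢0 _ → ⊥-elim (0≢0 refl) })

  scaledWeight≡2^E : scaledWeight G S u ≡ 2 ^ suc n
  scaledWeight≡2^E = trans (sum-cong-≗ term) (sum-point u (2 ^ suc n))
    where
    term : ∀ v → scaledTerm (suc n) (S v) (dist G S u v) ≡ point u (2 ^ suc n) v
    term v with v ≟ u
    ... | yes refl = let (d , dist≡ , d≤0) = path⇒dist≤ G S u u (u ∷ [] , selfPath) in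
                     trans (cong₂ (scaledTerm (suc n)) u∈S dist≡) (cong (λ d → 2 ^ (suc n ∸ d)) (ℕ.n≤0⇒n≡0 d≤0))
    ... | no  v≢u  = unreachable (S v) refl
      where
      unreachable : ∀ b → S v ≡ b → scaledTerm (suc n) b (dist G S u v) ≡ 0
      unreachable false _   = refl
      unreachable true  v∈S = cong (scaledTerm (suc n) true) (¬path⇒dist≡nothing G S u v
        λ _ _ (_ , _ , _ , _ , _ , one-endpoint , _) → v≢u (sym (one-endpoint (cong₂ _∧_ u∈S v∈S))))

scaledWeight-≤ : ∀ {n} (G : Graph n) S → (∀ v → deg G v ≤ 3) → ∀ u → deg G u ≤ 2 →
                 scaledWeight G S u ≤ 2 ^ suc n
scaledWeight-≤ G S maxDeg≤3 u deg-u≤2 with S u ≟ᵇ true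
... | yes u∈S = ℕ.≤-reflexive (scaledWeight≡2^E G S u∈S)
... | no  u∉S = Exploration.scaledWeight-≤ G S u (¬-not u∉S) maxDeg≤3 deg-u≤2

scaledWeight≡2^E⇔GoodTree : ∀ {n} (G : Graph n) S → (∀ v → deg G v ≤ 3) → ∀ u → deg G u ≤ 2 →
                            scaledWeight G S u ≡ 2 ^ suc n ⇔ GoodTree G S u
scaledWeight≡2^E⇔GoodTree G S maxDeg≤3 u deg-u≤2 with S u ≟ᵇ true
... | yes u∈S = mk⇔ (λ _ → leaf , ([] ∷ []) , (u∈S ∷ []) , []) (λ _ → scaledWeight≡2^E G S u∈S)
... | no  u∉S = mk⇔ (Exploration.Extremal.goodTree G S u (¬-not u∉S) maxDeg≤3 deg-u≤2)
                    (ℕ.≤-antisym (scaledWeight-≤ G S maxDeg≤3 u deg-u≤2) ∘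
                     TreePaths.GoodTree⇒2^E≤scaledWeight G S (¬-not u∉S))

lemma1 : ∀ {n} (G : Graph n) (S : VSet n) →
         (∀ v → deg G v ≤ 3) →
         (u : Fin n) → deg G u ≤ 2 →
         (weight G S u ≤ℚ 2ℚ) × ((weight G S u ≡ 2ℚ) ⇔ GoodTree G S u)
lemma1 G S maxDeg≤3 u deg-u≤2 =
  let (weight≤2 , weight≡2⇔) = weight-bound G S u (scaledWeight-≤ G S maxDeg≤3 u deg-u≤2) in
  weight≤2 , scaledWeight≡2^E⇔GoodTree G S maxDeg≤3 u deg-u≤2 ⇔-∘ weight≡2⇔
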